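{- (1) If $\mathcal{V}$ is an involution variety of languages, then the class $\mathbf{V}$ of finite involution semigroups generated (as a pseudovariety) by the syntactic $\star$-semigroups of the languages in $\mathcal{V}$ is a pseudovariety of finite involution semigroups. (2) If $\mathbf{V}$ is a pseudovariety of finite involution semigroups, then the function $\mathcal{V}$ mapping each finite involutory alphabet $(A,\dagger)$ to the set of languages $L\subseteq A^{+}$ recognised by involution semigroups in $\mathbf{V}$ is an involution variety of languages.
   Context: Involution semigroup $(S,\star)$: $(a^\star)^\star=a$, $(ab)^\star=b^\star a^\star$; morphisms commute with involutions; a pseudovariety of finite involution semigroups is a class closed under finite direct products (involution componentwise), sub-$\star$-semigroups and quotients. A finite involutory alphabet $(A,\dagger)$ is a finite set with bijection $\dagger$, $(a^\dagger)^\dagger=a$, extended to words by $(a_1\cdots a_n)^\dagger=a_n^\dagger\cdots a_1^\dagger$. $(S,\star)$ recognises $L\subseteq A^{+}$ if $L=h^{ -1}(P)$ for a morphism of involution semigroups $h:(A^{+},\dagger)\to(S,\star)$ and $P\subseteq S$. An involution variety of languages assigns to each $(A,\dagger)$ a family of regular languages over $A$ that is a Boolean algebra, closed under quotients $a^{ -1}L$, $La^{ -1}$ ($a\in A$), under $L\mapsto L^\dagger=\{w^\dagger:w\in L\}$, and under inverse images by morphisms of involution semigroups $(A^{+},\dagger)\to(B^{+},\star)$. The syntactic $\star$-semigroup of $L$ is $A^{+}/\approx_L$ where $x\approx_L y$ iff $x\sim_L y$ and $x\sim_{L^\dagger}y$ (with $x\sim_K y$ iff $\forall u,v\in A^*$,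 $uxv\in K\Leftrightarrow uyv\in K$), with involution $[\![w]\!]\mapsto[\![w^\dagger]\!]$. -}

module Defs where

open import Level using (Level; _⊔_) renaming (suc to lsuc; zero to lzero)
open import Data.Nat using (ℕ; _*_)
open import Data.Fin using (Fin)
open import Data.Fin.Properties using (*↔×; 1↔⊤)
open import Data.Bool using (Bool; true; false; not; _∧_; _∨_)
open import Data.Unit using (⊤; tt)
open import Data.Product using (Σ; ∃; _×_; _,_; proj₁; proj₂)
open import Data.List using (List; foldl)
open import Data.List.NonEmpty using (List⁺; _⁺++⁺_; _⁺++_; _++⁺_; _∷⁺_; _⁺∷ʳ_; reverse; map; toList)
open import Function.Bundles using (_↔_; _⇔_)
open import Function.Properties.Inverse using (↔-trans)
open import Data.Product.Function.NonDependent.Propositional using (_×-↔_)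
open import Relation.Binary.PropositionalEquality using (_≡_; refl)

Finite : Set → Set
Finite X = Σ ℕ (λ n → Fin n ↔ X)

record FinInvSg : Set₁ where
  infixl 7 _∙_
  field
    Carrier : Set
    finite  : Finite Carrier
    _∙_     : Carrier → Carrier → Carrier
    _⋆      : Carrier → Carrier
    assoc   : ∀ x y z → (x ∙ y) ∙ z ≡ x ∙ (y ∙ z)
    ⋆-invol : ∀ x → (x ⋆) ⋆ ≡ x
    ⋆-anti  : ∀ x y → (x ∙ y) ⋆ ≡ (y ⋆) ∙ (x ⋆)

open FinInvSg

record Hom (S T : FinInvSg) : Set where
  field
    fun   : Carrier S → Carrier T
    fun-∙ : ∀ x y → fun (_∙_ S x y) ≡ _∙_ T (fun x) (fun y)
    fun-⋆ : ∀ x → fun (_⋆ S x) ≡ _⋆ T (fun x)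

open Hom

Injective : {X Y : Set} → (X → Y) → Set
Injective f = ∀ x y → f x ≡ f y → x ≡ y

Surjective : {X Y : Set} → (X → Y) → Set
Surjective {X} f = ∀ y → ∃ λ x → f x ≡ y

-- Trivial (one-element) involution semigroup = empty direct product.
trivialSg : FinInvSg
trivialSg = record
  { Carrier = ⊤ ; finite = 1 , 1↔⊤ ; _∙_ = λ _ _ → tt ; _⋆ = λ _ → tt
  ; assoc = λ _ _ _ → refl ; ⋆-invol = λ _ → refl ; ⋆-anti = λ _ _ → refl }

_⊗_ : FinInvSg → FinInvSg → FinInvSg
S ⊗ T = record
  { Carrier = Carrier S × Carrier T
  ; finite  = (proj₁ (finite S) * proj₁ (finite T))
            , ↔-trans *↔× (proj₂ (finite S) ×-↔ proj₂ (finite T))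
  ; _∙_     = λ { (a , b) (c , d) → (_∙_ S a c , _∙_ T b d) }
  ; _⋆      = λ { (a , b) → (_⋆ S a , _⋆ T b) }
  ; assoc   = λ { (a , b) (c , d) (e , f) → cong₂′ (assoc S a c e) (assoc T b d f) }
  ; ⋆-invol = λ { (a , b) → cong₂′ (⋆-invol S a) (⋆-invol T b) }
  ; ⋆-anti  = λ { (a , b) (c , d) → cong₂′ (⋆-anti S a c) (⋆-anti T b d) } }
  where
  cong₂′ : {X Y : Set} {x x′ : X} {y y′ : Y} → x ≡ x′ → y ≡ y′ → (x , y) ≡ (x′ , y′)
  cong₂′ refl refl = refl

-- Pseudovariety of finite involution semigroups: closed under finite direct
-- products (including the empty one), sub-⋆-semigroups (injective morphisms,
-- hence also isomorphic copies) and quotients (surjective morphisms).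
record IsPseudovariety {ℓ : Level} (V : FinInvSg → Set ℓ) : Set (lsuc lzero ⊔ ℓ) where
  field
    trivial : V trivialSg
    product : ∀ S T → V S → V T → V (S ⊗ T)
    sub     : ∀ S T (f : Hom T S) → Injective (fun f) → V S → V T
    quot    : ∀ S T (f : Hom S T) → Surjective (fun f) → V S → V T

data Gen {ℓ : Level} (G : FinInvSg → Set ℓ) : FinInvSg → Set (lsuc lzero ⊔ ℓ) where
  gen     : ∀ {S} → G S → Gen G S
  trivial : Gen G trivialSg
  product : ∀ {S T} → Gen G S → Gen G T → Gen G (S ⊗ T)
  sub     : ∀ {S T} (f : Hom T S) → Injective (fun f) → Gen G S → Gen G T
  quot    : ∀ {S T} (f : Hom S T) → Surjective (fun f) → Gen G S → Gen G T

record InvAlph : Set₁ where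
  field
    Letter   : Set
    finiteA  : Finite Letter
    _†       : Letter → Letter
    †-invol  : ∀ a → (a †) † ≡ a

open InvAlph

-- A⁺ (nonempty words); A* is List.
Word : InvAlph → Set
Word A = List⁺ (Letter A)

dagW : (A : InvAlph) → Word A → Word A
dagW A w = reverse (map (_† A) w)

Lang : InvAlph → Set
Lang A = Word A → Bool

dagL : (A : InvAlph) → Lang A → Lang A
dagL A L w = L (dagW A w)

record DFA (A : InvAlph) : Set where
  field
    states : ℕ
    δ      : Fin states → Letter A → Fin states
    start  : Fin states
    final  : Fin states → Bool

accepts : {A : InvAlph} → DFA A → Word A → Bool
accepts D w = DFA.final D (foldl (DFA.δ D) (DFA.start D) (toList w))

Regular : (A : InvAlph) → Lang A → Set
Regular A L = ∃ λ (D : DFA A) → ∀ w → L w ≡ accepts D w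

record FreeHom (A : InvAlph) (S : FinInvSg) : Set where
  field
    hfun   : Word A → Carrier S
    hfun-∙ : ∀ x y → hfun (x ⁺++⁺ y) ≡ _∙_ S (hfun x) (hfun y)
    hfun-† : ∀ x → hfun (dagW A x) ≡ _⋆ S (hfun x)

open FreeHom

record FreeMor (A B : InvAlph) : Set where
  field
    φ   : Word A → Word B
    φ-∙ : ∀ x y → φ (x ⁺++⁺ y) ≡ φ x ⁺++⁺ φ y
    φ-† : ∀ x → φ (dagW A x) ≡ dagW B (φ x)

open FreeMor

Recognises : (S : FinInvSg) (A : InvAlph) → Lang A → Set
Recognises S A L =
  Σ (FreeHom A S) λ h → Σ (Carrier S → Bool) λ P → ∀ w → L w ≡ P (hfun h w)

Synt : (A : InvAlph) → Lang A → Word A → Word A → Set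
Synt A L x y = ∀ (u v : List (Letter A)) → L (u ++⁺ (x ⁺++ v)) ≡ L (u ++⁺ (y ⁺++ v))

SyntStar : (A : InvAlph) → Lang A → Word A → Word A → Set
SyntStar A L x y = Synt A L x y × Synt A (dagL A L) x y

-- S is (a copy of) the syntactic ⋆-semigroup A⁺/≈_L with involution [w] ↦ [w†]:
-- there is a surjective morphism (A⁺,†) → (S,⋆) whose kernel is exactly ≈_L.
IsSyntacticStar : (A : InvAlph) → Lang A → FinInvSg → Set
IsSyntacticStar A L S =
  Σ (FreeHom A S) λ h → Surjective (hfun h)
    × (∀ x y → (hfun h x ≡ hfun h y) ⇔ SyntStar A L x y)

LangClass : (ℓ : Level) → Set (lsuc lzero ⊔ lsuc ℓ)
LangClass ℓ = (A : InvAlph) → Lang A → Set ℓ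

record IsInvVariety {ℓ : Level} (𝒱 : LangClass ℓ) : Set (lsuc lzero ⊔ ℓ) where
  field
    regular  : ∀ A L → 𝒱 A L → Regular A L
    empty    : ∀ A → 𝒱 A (λ _ → false)
    full     : ∀ A → 𝒱 A (λ _ → true)
    union    : ∀ A L K → 𝒱 A L → 𝒱 A K → 𝒱 A (λ w → L w ∨ K w)
    inter    : ∀ A L K → 𝒱 A L → 𝒱 A K → 𝒱 A (λ w → L w ∧ K w)
    compl    : ∀ A L → 𝒱 A L → 𝒱 A (λ w → not (L w))
    lquot    : ∀ A L (a : Letter A) → 𝒱 A L → 𝒱 A (λ w → L (a ∷⁺ w))
    rquot    : ∀ A L (a : Letter A) → 𝒱 A L → 𝒱 A (λ w → L (w ⁺∷ʳ a))
    dagger   : ∀ A L → 𝒱 A L → 𝒱 A (dagL A L)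
    invImage : ∀ A B (f : FreeMor A B) L → 𝒱 B L → 𝒱 A (λ w → L (φ f w))

SyntPV : {ℓ : Level} → LangClass ℓ → FinInvSg → Set (lsuc lzero ⊔ ℓ)
SyntPV 𝒱 = Gen (λ S → Σ InvAlph λ A → Σ (Lang A) λ L → 𝒱 A L × IsSyntacticStar A L S)

RecLangs : {ℓ : Level} → (FinInvSg → Set ℓ) → LangClass (lsuc lzero ⊔ ℓ)
RecLangs V A L = Σ FinInvSg λ S → V S × Recognises S A L

{-# OPTIONS --safe #-}
module Submission where

open import Defs
open import Level using (Level)
open import Data.Product using (_×_; _,_; proj₁; proj₂)
open import Data.Bool using (Bool; true; false; not; _∧_; _∨_)
open import Data.Unit using (tt)
open import Data.Nat using (suc)
open import Data.Fin using (Fin; zero; suc)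
open import Data.List as List using (List; []; _∷_; foldl)
open import Data.List.Properties using (++-assoc; ++-identityʳ)
open import Data.List.NonEmpty using (List⁺; _∷_; [_]; _⁺++⁺_; _⁺++_; _∷⁺_; _⁺∷ʳ_)
open import Function.Bundles using (Inverse)
open import Relation.Binary.PropositionalEquality
  using (_≡_; refl; trans; sym; cong; cong₂; module ≡-Reasoning)

open FinInvSg
open FreeHom
open FreeMor
open InvAlph

Gen-isPseudovariety : {ℓ : Level} (G : FinInvSg → Set ℓ) → IsPseudovariety (Gen G)
Gen-isPseudovariety G = record
  { trivial = trivial
  ; product = λ _ _ → product
  ; sub     = λ _ _ → sub
  ; quot    = λ _ _ → quot
  }

⁺++-identityʳ : {X : Set} (w : List⁺ X) → w ⁺++ [] ≡ w
⁺++-identityʳ (x ∷ xs) = cong (x ∷_) (++-identityʳ xs)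

⁺++-∷ : {X : Set} (w : List⁺ X) (y : X) (ys : List X) → (w ⁺++⁺ [ y ]) ⁺++ ys ≡ w ⁺++ (y ∷ ys)
⁺++-∷ (x ∷ xs) y ys = cong (x ∷_) (++-assoc xs List.[ y ] ys)

∷⁺-as-⁺++⁺ : {X : Set} (a : X) (w : List⁺ X) → a ∷⁺ w ≡ [ a ] ⁺++⁺ w
∷⁺-as-⁺++⁺ a (x ∷ xs) = refl

⁺∷ʳ-as-⁺++⁺ : {X : Set} (a : X) (w : List⁺ X) → w ⁺∷ʳ a ≡ w ⁺++⁺ [ a ]
⁺∷ʳ-as-⁺++⁺ a (x ∷ xs) = refl

trivialHom : (A : InvAlph) → FreeHom A trivialSg
trivialHom A = record { hfun = λ _ → tt ; hfun-∙ = λ _ _ → refl ; hfun-† = λ _ → refl }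

pairHom : {A : InvAlph} {S T : FinInvSg} → FreeHom A S → FreeHom A T → FreeHom A (S ⊗ T)
pairHom h k = record
  { hfun   = λ w → hfun h w , hfun k w
  ; hfun-∙ = λ x y → cong₂ _,_ (hfun-∙ h x y) (hfun-∙ k x y)
  ; hfun-† = λ x → cong₂ _,_ (hfun-† h x) (hfun-† k x)
  }

precomposeHom : {A B : InvAlph} {S : FinInvSg} → FreeMor A B → FreeHom B S → FreeHom A S
precomposeHom f h = record
  { hfun   = λ w → hfun h (φ f w)
  ; hfun-∙ = λ x y → trans (cong (hfun h) (φ-∙ f x y)) (hfun-∙ h (φ f x) (φ f y))
  ; hfun-† = λ x → trans (cong (hfun h) (φ-† f x)) (hfun-† h (φ f x))
  }

module _ {A : InvAlph} {S : FinInvSg} (h : FreeHom A S) (P : Carrier S → Bool) where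

  private
    n = proj₁ (finite S)
    open Inverse (proj₂ (finite S)) using (to; from; strictlyInverseˡ)

    ⌜_⌝ : Carrier S → Fin (suc n)
    ⌜ s ⌝ = suc (from s)

    -- The extra state zero stands for the empty word, which has no image in S.
    δ : Fin (suc n) → Letter A → Fin (suc n)
    δ zero    a = ⌜ hfun h [ a ] ⌝
    δ (suc i) a = ⌜ _∙_ S (to i) (hfun h [ a ]) ⌝

    final : Fin (suc n) → Bool
    final zero    = false
    final (suc i) = P (to i)

    run : ∀ w xs → foldl δ ⌜ hfun h w ⌝ xs ≡ ⌜ hfun h (w ⁺++ xs) ⌝
    run w [] = cong (λ v → ⌜ hfun h v ⌝) (sym (⁺++-identityʳ w))
    run w (y ∷ ys) = begin
      foldl δ ⌜ _∙_ S (to (from (hfun h w))) (hfun h [ y ]) ⌝ ys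
        ≡⟨ cong (λ s → foldl δ ⌜ _∙_ S s (hfun h [ y ]) ⌝ ys) (strictlyInverseˡ (hfun h w)) ⟩
      foldl δ ⌜ _∙_ S (hfun h w) (hfun h [ y ]) ⌝ ys
        ≡⟨ cong (λ s → foldl δ ⌜ s ⌝ ys) (sym (hfun-∙ h w [ y ])) ⟩
      foldl δ ⌜ hfun h (w ⁺++⁺ [ y ]) ⌝ ys
        ≡⟨ run (w ⁺++⁺ [ y ]) ys ⟩
      ⌜ hfun h ((w ⁺++⁺ [ y ]) ⁺++ ys) ⌝
        ≡⟨ cong (λ v → ⌜ hfun h v ⌝) (⁺++-∷ w y ys) ⟩
      ⌜ hfun h (w ⁺++ (y ∷ ys)) ⌝ ∎
      where open ≡-Reasoning

  recognitionDFA : DFA A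
  recognitionDFA = record { states = suc n ; δ = δ ; start = zero ; final = final }

  accepts-recognitionDFA : ∀ w → accepts recognitionDFA w ≡ P (hfun h w)
  accepts-recognitionDFA (x ∷ xs) =
    trans (cong final (run [ x ] xs)) (cong P (strictlyInverseˡ (hfun h (x ∷ xs))))

recognisable⇒regular : ∀ {S A L} → Recognises S A L → Regular A L
recognisable⇒regular (h , P , L≡P∘h) =
  recognitionDFA h P , λ w → trans (L≡P∘h w) (sym (accepts-recognitionDFA h P w))

recognises-trivial : ∀ A (b : Bool) → Recognises trivialSg A (λ _ → b)
recognises-trivial A b = trivialHom A , (λ _ → b) , λ _ → refl

recognises-⊗ : ∀ {S T A L K} (f : Bool → Bool → Bool) →
  Recognises S A L → Recognises T A K → Recognises (S ⊗ T) A (λ w → f (L w) (K w))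
recognises-⊗ f (h , P , eL) (k , Q , eK) =
  pairHom h k , (λ (s , t) → f (P s) (Q t)) , λ w → cong₂ f (eL w) (eK w)

recognises-not : ∀ {S A L} → Recognises S A L → Recognises S A (λ w → not (L w))
recognises-not (h , P , e) = h , (λ s → not (P s)) , λ w → cong not (e w)

-- Quotients by a letter and the involution change a word by a map that h turns
-- into a multiplication or ⋆ in S, so h itself still recognises the result.
recognises-transport : ∀ {S A L} (t : Word A → Word A) (g : Carrier S → Carrier S) →
  (rec : Recognises S A L) → (∀ w → hfun (proj₁ rec) (t w) ≡ g (hfun (proj₁ rec) w)) →
  Recognises S A (λ w → L (t w))
recognises-transport t g (h , P , e) h∘t≡g∘h =
  h , (λ s → P (g s)) , λ w → trans (e (t w)) (cong P (h∘t≡g∘h w))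

recognises-lquot : ∀ {S A L} (a : Letter A) → Recognises S A L → Recognises S A (λ w → L (a ∷⁺ w))
recognises-lquot {S} a rec@(h , _) = recognises-transport (a ∷⁺_) (_∙_ S (hfun h [ a ])) rec
  λ w → trans (cong (hfun h) (∷⁺-as-⁺++⁺ a w)) (hfun-∙ h [ a ] w)

recognises-rquot : ∀ {S A L} (a : Letter A) → Recognises S A L → Recognises S A (λ w → L (w ⁺∷ʳ a))
recognises-rquot {S} a rec@(h , _) = recognises-transport (_⁺∷ʳ a) (λ s → _∙_ S s (hfun h [ a ])) rec
  λ w → trans (cong (hfun h) (⁺∷ʳ-as-⁺++⁺ a w)) (hfun-∙ h w [ a ])

recognises-dagger : ∀ {S A L} → Recognises S A L → Recognises S A (dagL A L)
recognises-dagger {S} {A} rec@(h , _) = recognises-transport (dagW A) (_⋆ S) rec (hfun-† h)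

recognises-invImage : ∀ {S A B L} (f : FreeMor A B) →
  Recognises S B L → Recognises S A (λ w → L (φ f w))
recognises-invImage f (h , P , e) = precomposeHom f h , P , λ w → e (φ f w)

RecLangs-isInvVariety : {ℓ : Level} (V : FinInvSg → Set ℓ) → IsPseudovariety V →
  IsInvVariety (RecLangs V)
RecLangs-isInvVariety V PV = record
  { regular  = λ { _ _ (_ , _ , rec) → recognisable⇒regular rec }
  ; empty    = λ A → trivialSg , PV.trivial , recognises-trivial A false
  ; full     = λ A → trivialSg , PV.trivial , recognises-trivial A true
  ; union    = binary _∨_
  ; inter    = binary _∧_
  ; compl    = λ { _ _ (S , vS , rec) → S , vS , recognises-not rec }
  ; lquot    = λ { _ _ a (S , vS , rec) → S , vS , recognises-lquot a rec }
  ; rquot    = λ { _ _ a (S , vS , rec) → S , vS , recognises-rquot a rec }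
  ; dagger   = λ { _ _ (S , vS , rec) → S , vS , recognises-dagger rec }
  ; invImage = λ { _ _ f _ (S , vS , rec) → S , vS , recognises-invImage f rec }
  }
  where
  module PV = IsPseudovariety PV

  binary : (f : Bool → Bool → Bool) → ∀ A L K →
    RecLangs V A L → RecLangs V A K → RecLangs V A (λ w → f (L w) (K w))
  binary f A L K (S , vS , recL) (T , vT , recK) =
    S ⊗ T , PV.product S T vS vT , recognises-⊗ f recL recK

lemma8 : {ℓ : Level} →
    ((𝒱 : LangClass ℓ) → IsInvVariety 𝒱 → IsPseudovariety (SyntPV 𝒱))
    × ((V : FinInvSg → Set ℓ) → IsPseudovariety V → IsInvVariety (RecLangs V))
lemma8 = (λ 𝒱 _ → Gen-isPseudovariety _) , RecLangs-isInvVariety
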